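{- If $m$, $n$ and $k$ are positive integers such that $m\geqslant k$ and $n\geqslant k$, then ${\rm SP}(m+n,k)\geqslant k\cdot{\rm SP}(m,k)\cdot{\rm SP}(n,k)$.
   Context: For integers $n\geqslant k\geqslant 1$, an $(n,k)$-Sperner partition system is a collection of partitions of some $n$-element set, each into exactly $k$ nonempty classes, such that no class of any partition in the collection is a subset of a class of any other partition in the collection; ${\rm SP}(n,k)$ denotes the maximum number of partitions in such a system. -}

module Defs where

open import Data.Nat using (ℕ; _≤_)
open import Data.Fin using (Fin)
open import Data.Product using (Σ; ∃; _×_)
open import Relation.Binary.PropositionalEquality using (_≡_; _≢_)
open import Relation.Nullary using (¬_)

-- A partition of the n-element set Fin n into exactly k nonempty classes,
-- given by a class-labelling map that hits every label (so every class is nonempty).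
-- Class number c of f is the preimage { x | f x ≡ c }.
record KPartition (n k : ℕ) : Set where
  field
    label    : Fin n → Fin k
    nonempty : ∀ (c : Fin k) → ∃ λ (x : Fin n) → label x ≡ c
open KPartition public

ClassSubset : ∀ {n k} → KPartition n k → Fin k → KPartition n k → Fin k → Set
ClassSubset P c Q d = ∀ x → label P x ≡ c → label Q x ≡ d

record SpernerSystem (n k N : ℕ) : Set where
  field
    part    : Fin N → KPartition n k
    sperner : ∀ (i j : Fin N) → i ≢ j → ∀ (c d : Fin k) →
              ¬ ClassSubset (part i) c (part j) d
open SpernerSystem public

IsSP : ℕ → ℕ → ℕ → Set
IsSP n k s = SpernerSystem n k s × (∀ N → SpernerSystem n k N → N ≤ s)

-- Glue a partition P from an (m,k)-system to a partition Q from an (n,k)-system,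
-- relabelling the classes of Q by one of the k rows of a Latin square of order k.
-- If one glued class lies inside another, restricting to the first m points forces
-- the same P, restricting to the last n points forces the same Q, and then the two
-- relabellings agree somewhere, which in a Latin square forces the same row.
-- So the k·a·b glued partitions form an (m+n,k)-system.
module Submission where

open import Defs
open import Data.Nat using (ℕ; suc; _+_; _*_; _∸_; _%_; _≤_; _≥_; NonZero)
open import Data.Nat.Properties using (+-comm; +-assoc; m∸n+n≡m; <⇒≤)
open import Data.Nat.DivMod using (m%n<n; %-distribˡ-+; m%n%n≡m%n; n%n≡0; m<n⇒m%n≡m)
open import Data.Fin using (Fin; toℕ; fromℕ<; splitAt; _↑ˡ_; _↑ʳ_)
open import Data.Fin.Properties using (toℕ-injective; toℕ-fromℕ<; toℕ<n; splitAt-↑ˡ; splitAt-↑ʳ; _≟_; *↔×)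
open import Data.Fin.Permutation using (Permutation′; permutation; _⟨$⟩ʳ_; _⟨$⟩ˡ_; inverseʳ; inverseˡ)
open import Data.Product using (∃; _×_; _,_)
open import Data.Product.Function.NonDependent.Propositional using (_×-↔_)
open import Data.Sum using ([_,_]′)
open import Function using (_∘_; _↣_; Injection)
open import Function.Construct.Composition using (_↔-∘_)
open import Function.Construct.Identity using (↔-id)
open import Function.Properties.Inverse using (↔⇒↣)
open import Relation.Binary.PropositionalEquality
open import Relation.Nullary.Decidable using (decidable-stable)

record LatinSquare (k : ℕ) : Set where
  field
    row              : Fin k → Permutation′ k
    column-injective : ∀ {s t} x → row s ⟨$⟩ʳ x ≡ row t ⟨$⟩ʳ x → s ≡ t
open LatinSquare

module CyclicLatinSquare (k : ℕ) .{{_ : NonZero k}} where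

  [m+n%k]%k≡[m+n]%k : ∀ m n → (m + n % k) % k ≡ (m + n) % k
  [m+n%k]%k≡[m+n]%k m n = begin
    (m + n % k) % k           ≡⟨ %-distribˡ-+ m (n % k) k ⟩
    (m % k + n % k % k) % k   ≡⟨ cong (λ t → (m % k + t) % k) (m%n%n≡m%n n k) ⟩
    (m % k + n % k) % k       ≡⟨ %-distribˡ-+ m n k ⟨
    (m + n) % k               ∎
    where open ≡-Reasoning

  rotate : Fin k → Fin k → Fin k
  rotate s x = fromℕ< (m%n<n (toℕ s + toℕ x) k)

  toℕ-rotate : ∀ s x → toℕ (rotate s x) ≡ (toℕ s + toℕ x) % k
  toℕ-rotate s x = toℕ-fromℕ< (m%n<n (toℕ s + toℕ x) k)

  rotate-comm : ∀ s x → rotate s x ≡ rotate x s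
  rotate-comm s x = toℕ-injective (begin
    toℕ (rotate s x)       ≡⟨ toℕ-rotate s x ⟩
    (toℕ s + toℕ x) % k    ≡⟨ cong (_% k) (+-comm (toℕ s) (toℕ x)) ⟩
    (toℕ x + toℕ s) % k    ≡⟨ toℕ-rotate x s ⟨
    toℕ (rotate x s)       ∎)
    where open ≡-Reasoning

  rotate-cancel : ∀ s t x → (toℕ s + toℕ t) % k ≡ 0 → rotate s (rotate t x) ≡ x
  rotate-cancel s t x s+t≡0 = toℕ-injective (begin
    toℕ (rotate s (rotate t x))          ≡⟨ toℕ-rotate s (rotate t x) ⟩
    (toℕ s + toℕ (rotate t x)) % k       ≡⟨ cong (λ u → (toℕ s + u) % k) (toℕ-rotate t x) ⟩
    (toℕ s + (toℕ t + toℕ x) % k) % k    ≡⟨ [m+n%k]%k≡[m+n]%k (toℕ s) (toℕ t + toℕ x) ⟩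
    (toℕ s + (toℕ t + toℕ x)) % k        ≡⟨ cong (_% k) (+-assoc (toℕ s) (toℕ t) (toℕ x)) ⟨
    (toℕ s + toℕ t + toℕ x) % k          ≡⟨ %-distribˡ-+ (toℕ s + toℕ t) (toℕ x) k ⟩
    ((toℕ s + toℕ t) % k + toℕ x % k) % k ≡⟨ cong (λ u → (u + toℕ x % k) % k) s+t≡0 ⟩
    toℕ x % k % k                        ≡⟨ m%n%n≡m%n (toℕ x) k ⟩
    toℕ x % k                            ≡⟨ m<n⇒m%n≡m (toℕ<n x) ⟩
    toℕ x                                ∎)
    where open ≡-Reasoning

  negate : Fin k → Fin k
  negate s = fromℕ< (m%n<n (k ∸ toℕ s) k)

  [s+negate-s]%k≡0 : ∀ s → (toℕ s + toℕ (negate s)) % k ≡ 0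
  [s+negate-s]%k≡0 s = begin
    (toℕ s + toℕ (negate s)) % k     ≡⟨ cong (λ u → (toℕ s + u) % k) (toℕ-fromℕ< (m%n<n (k ∸ toℕ s) k)) ⟩
    (toℕ s + (k ∸ toℕ s) % k) % k    ≡⟨ [m+n%k]%k≡[m+n]%k (toℕ s) (k ∸ toℕ s) ⟩
    (toℕ s + (k ∸ toℕ s)) % k        ≡⟨ cong (_% k) (+-comm (toℕ s) (k ∸ toℕ s)) ⟩
    (k ∸ toℕ s + toℕ s) % k          ≡⟨ cong (_% k) (m∸n+n≡m (<⇒≤ (toℕ<n s))) ⟩
    k % k                            ≡⟨ n%n≡0 k ⟩
    0                                ∎
    where open ≡-Reasoning

  [negate-s+s]%k≡0 : ∀ s → (toℕ (negate s) + toℕ s) % k ≡ 0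
  [negate-s+s]%k≡0 s = trans (cong (_% k) (+-comm (toℕ (negate s)) (toℕ s))) ([s+negate-s]%k≡0 s)

  cyclicLatinSquare : LatinSquare k
  row cyclicLatinSquare s = permutation (rotate s) (rotate (negate s))
    (λ x → rotate-cancel s (negate s) x ([s+negate-s]%k≡0 s))
    (λ x → rotate-cancel (negate s) s x ([negate-s+s]%k≡0 s))
  column-injective cyclicLatinSquare {s} {t} x sx≡tx = begin
    s                              ≡⟨ rotate-cancel (negate x) x s ([negate-s+s]%k≡0 x) ⟨
    rotate (negate x) (rotate x s) ≡⟨ cong (rotate (negate x)) (trans (rotate-comm x s) (trans sx≡tx (rotate-comm t x))) ⟩
    rotate (negate x) (rotate x t) ≡⟨ rotate-cancel (negate x) x t ([negate-s+s]%k≡0 x) ⟩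
    t                              ∎
    where open ≡-Reasoning

ClassSubset-refl⇒≡ : ∀ {n k} (P : KPartition n k) {c d} → ClassSubset P c P d → c ≡ d
ClassSubset-refl⇒≡ P {c} P⊆P with nonempty P c
... | x , Px≡c = trans (sym Px≡c) (P⊆P x Px≡c)

module _ {m n k : ℕ} where

  -- Opaque, so that the glued partitions can be inferred from a ClassSubset between them.
  opaque
    glue : Permutation′ k → KPartition m k → KPartition n k → KPartition (m + n) k
    label (glue π P Q) = [ label P , (π ⟨$⟩ʳ_) ∘ label Q ]′ ∘ splitAt m
    nonempty (glue π P Q) c with nonempty P c
    ... | y , Py≡c = y ↑ˡ n , trans (cong [ label P , (π ⟨$⟩ʳ_) ∘ label Q ]′ (splitAt-↑ˡ m y n)) Py≡c

    label-glue-↑ˡ : ∀ π P Q y → label (glue π P Q) (y ↑ˡ n) ≡ label P y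
    label-glue-↑ˡ π P Q y rewrite splitAt-↑ˡ m y n = refl

    label-glue-↑ʳ : ∀ π P Q z → label (glue π P Q) (m ↑ʳ z) ≡ π ⟨$⟩ʳ label Q z
    label-glue-↑ʳ π P Q z rewrite splitAt-↑ʳ m n z = refl

  module _ {π ρ : Permutation′ k} {P P′ : KPartition m k} {Q Q′ : KPartition n k} {c d : Fin k}
           (⊆ : ClassSubset (glue π P Q) c (glue ρ P′ Q′) d) where

    ClassSubset-glueˡ : ClassSubset P c P′ d
    ClassSubset-glueˡ y Py≡c = begin
      label P′ y                    ≡⟨ label-glue-↑ˡ ρ P′ Q′ y ⟨
      label (glue ρ P′ Q′) (y ↑ˡ n) ≡⟨ ⊆ (y ↑ˡ n) (trans (label-glue-↑ˡ π P Q y) Py≡c) ⟩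
      d                             ∎
      where open ≡-Reasoning

    ClassSubset-glueʳ : ClassSubset Q (π ⟨$⟩ˡ c) Q′ (ρ ⟨$⟩ˡ d)
    ClassSubset-glueʳ z Qz≡π⁻¹c = begin
      label Q′ z                          ≡⟨ inverseˡ ρ ⟨
      ρ ⟨$⟩ˡ (ρ ⟨$⟩ʳ label Q′ z)           ≡⟨ cong (ρ ⟨$⟩ˡ_) (label-glue-↑ʳ ρ P′ Q′ z) ⟨
      ρ ⟨$⟩ˡ label (glue ρ P′ Q′) (m ↑ʳ z) ≡⟨ cong (ρ ⟨$⟩ˡ_) (⊆ (m ↑ʳ z) πQz≡c) ⟩
      ρ ⟨$⟩ˡ d                            ∎
      where
      open ≡-Reasoning
      πQz≡c : label (glue π P Q) (m ↑ʳ z) ≡ c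
      πQz≡c = trans (label-glue-↑ʳ π P Q z) (trans (cong (π ⟨$⟩ʳ_) Qz≡π⁻¹c) (inverseʳ π))

ClassSubset-glue⇒agree : ∀ {m n k} {π ρ : Permutation′ k} {P : KPartition m k} {Q : KPartition n k} {c d} →
                         ClassSubset (glue π P Q) c (glue ρ P Q) d → ∃ λ x → π ⟨$⟩ʳ x ≡ ρ ⟨$⟩ʳ x
ClassSubset-glue⇒agree {π = π} {ρ} {P} {Q} {c} {d} ⊆ = π ⟨$⟩ˡ c , (begin
  π ⟨$⟩ʳ (π ⟨$⟩ˡ c) ≡⟨ inverseʳ π ⟩
  c                ≡⟨ ClassSubset-refl⇒≡ P (ClassSubset-glueˡ ⊆) ⟩
  d                ≡⟨ inverseʳ ρ ⟨
  ρ ⟨$⟩ʳ (ρ ⟨$⟩ˡ d) ≡⟨ cong (ρ ⟨$⟩ʳ_) (ClassSubset-refl⇒≡ Q (ClassSubset-glueʳ ⊆)) ⟨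
  ρ ⟨$⟩ʳ (π ⟨$⟩ˡ c) ∎)
  where open ≡-Reasoning

spernerSystem : ∀ {n k N} {A : Set} → Fin N ↣ A → (P : A → KPartition n k) →
                (∀ x y {c d} → ClassSubset (P x) c (P y) d → x ≡ y) → SpernerSystem n k N
part (spernerSystem ι P _) = P ∘ Injection.to ι
sperner (spernerSystem ι P separated) i j i≢j c d ⊆ = i≢j (Injection.injective ι (separated _ _ ⊆))

module _ {m n k a b : ℕ} (L : LatinSquare k) (S : SpernerSystem m k a) (T : SpernerSystem n k b) where

  gluedPart : (Fin k × Fin a) × Fin b → KPartition (m + n) k
  gluedPart ((s , i) , j) = glue (row L s) (part S i) (part T j)

  gluedPart-separated : ∀ x y {c d} → ClassSubset (gluedPart x) c (gluedPart y) d → x ≡ y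
  gluedPart-separated ((s , i) , j) ((t , i′) , j′) ⊆
    with refl ← decidable-stable (i ≟ i′) (λ i≢i′ → sperner S i i′ i≢i′ _ _ (ClassSubset-glueˡ ⊆))
       | refl ← decidable-stable (j ≟ j′) (λ j≢j′ → sperner T j j′ j≢j′ _ _ (ClassSubset-glueʳ ⊆))
    with x , sx≡tx ← ClassSubset-glue⇒agree ⊆
    = cong (λ s → (s , i) , j) (column-injective L x sx≡tx)

  gluedSystem : SpernerSystem (m + n) k (k * a * b)
  gluedSystem = spernerSystem (↔⇒↣ ((*↔× ×-↔ ↔-id _) ↔-∘ *↔×)) gluedPart gluedPart-separated

lemma7 : ∀ (m n k : ℕ) → 1 ≤ k → m ≥ k → n ≥ k →
         ∀ (a b c : ℕ) → IsSP m k a → IsSP n k b → IsSP (m + n) k c →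
         k * a * b ≤ c
lemma7 m n (suc k) _ _ _ a b c (S , _) (T , _) (_ , maximal) =
  maximal (suc k * a * b) (gluedSystem (CyclicLatinSquare.cyclicLatinSquare (suc k)) S T)
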